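{- Let $M=(E,\mathcal{I})$ be a matroid on a finite set $E$ with $r(M)>0$. Then $\bigcup F(M)=\bigcup\mathcal{B}(M)$.
   Context: $\mathcal{B}(M)$ is the family of bases, $r(M)$ the common cardinality of bases, $r(X)$ the rank of $X\subseteq E$. $s(M)=\{A\in\mathcal{I}: |A|=r(M)-1\}$. For $X\subseteq E$, $K_M(X)=\{a\in E: r(X\cup\{a\})=r(X)+1\}$. $F(M)=\{K_M(X): X\in s(M)\}$. -}

module Defs where

open import Data.Nat using (ℕ; suc; _<_; _≤_)
open import Data.Fin using (Fin)
open import Data.Fin.Subset using (Subset; ⊥; ⊤; ⁅_⁆; _∈_; _∉_; _⊆_; _∪_; ∣_∣)
open import Data.Product using (Σ; ∃; _×_)
open import Level using (Level; suc; _⊔_) renaming (zero to lzero)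
open import Relation.Binary.PropositionalEquality using (_≡_)

record Matroid (n : ℕ) : Set₁ where
  field
    Indep     : Subset n → Set
    indep-⊥   : Indep ⊥
    indep-⊆   : ∀ {X Y} → Y ⊆ X → Indep X → Indep Y
    exchange  : ∀ {X Y} → Indep X → Indep Y → ∣ X ∣ < ∣ Y ∣ →
                Σ (Fin n) λ y → y ∈ Y × y ∉ X × Indep (X ∪ ⁅ y ⁆)

module _ {n : ℕ} (M : Matroid n) where
  open Matroid M

  HasRank : Subset n → ℕ → Set
  HasRank X k =
    (Σ (Subset n) λ A → A ⊆ X × Indep A × ∣ A ∣ ≡ k)
    × (∀ A → A ⊆ X → Indep A → ∣ A ∣ ≤ k)

  IsBasis : Subset n → Set
  IsBasis B = Indep B × (∀ X → Indep X → B ⊆ X → X ⊆ B)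

  InK : Subset n → Fin n → Set
  InK X a = Σ ℕ λ k → HasRank X k × HasRank (X ∪ ⁅ a ⁆) (Data.Nat.suc k)

  -- a ∈ ⋃ F(M), where r(M) = suc k  (so s(M) = independent sets of size k).
  InUnionF : ℕ → Fin n → Set
  InUnionF k a = Σ (Subset n) λ A → Indep A × ∣ A ∣ ≡ k × InK A a

  InUnionB : Fin n → Set
  InUnionB a = Σ (Subset n) λ B → IsBasis B × a ∈ B

-- If r(A ∪ {a}) = r(A) + 1 for an independent A of size r(M) - 1, a maximum
-- independent subset of A ∪ {a} must use a (otherwise it would fit inside A)
-- and has size r(M), so it is a basis containing a.  Conversely, for a ∈ B ∈ 𝓑(M)
-- take A = B - a: it has rank r(M) - 1, and A ∪ {a} ⊇ B has rank r(M).
module Submission where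

open import Defs
open import Data.Nat using (ℕ; suc; _≤_; _<_; _≤?_; s≤s)
open import Data.Nat.Properties
  using (≤-antisym; ≤-<-trans; <-≤-trans; ≰⇒>; n≮n; suc-injective)
open import Data.Fin using (Fin; _≟_)
open import Data.Fin.Subset
open import Data.Fin.Subset.Properties
open import Data.Product using (_×_; _,_)
open import Data.Sum using (inj₁; inj₂)
open import Data.Vec using (_∷_; here; there)
open import Data.Empty using (⊥-elim)
open import Relation.Nullary using (yes; no)
open import Relation.Binary.PropositionalEquality using (_≡_; refl; sym; trans; cong; subst)

x∈p⇒∣p∣≡1+∣p-x∣ : ∀ {n} {p : Subset n} {x} → x ∈ p → ∣ p ∣ ≡ suc ∣ p - x ∣
x∈p⇒∣p∣≡1+∣p-x∣ {p = inside ∷ p}  here      = cong (λ q → suc ∣ q ∣) (sym (p─⊥≡p p))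
x∈p⇒∣p∣≡1+∣p-x∣ {p = inside ∷ p}  (there m) = cong suc (x∈p⇒∣p∣≡1+∣p-x∣ m)
x∈p⇒∣p∣≡1+∣p-x∣ {p = outside ∷ p} (there m) = x∈p⇒∣p∣≡1+∣p-x∣ m

module _ {n : ℕ} where

  x∉p⇒∣p∣<∣p∪⁅x⁆∣ : ∀ {p : Subset n} {x} → x ∉ p → ∣ p ∣ < ∣ p ∪ ⁅ x ⁆ ∣
  x∉p⇒∣p∣<∣p∪⁅x⁆∣ {p} {x} x∉p =
    p⊂q⇒∣p∣<∣q∣ (p⊆p∪q ⁅ x ⁆ , x , x∈p∪q⁺ (inj₂ (x∈⁅x⁆ x)) , x∉p)

  p⊆q∧x∈q⇒p∪⁅x⁆⊆q : ∀ {p q : Subset n} {x} → p ⊆ q → x ∈ q → p ∪ ⁅ x ⁆ ⊆ q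
  p⊆q∧x∈q⇒p∪⁅x⁆⊆q {p} {q} {x} p⊆q x∈q y∈ with x∈p∪q⁻ p ⁅ x ⁆ y∈
  ... | inj₁ y∈p = p⊆q y∈p
  ... | inj₂ y∈x = subst (_∈ q) (sym (x∈⁅y⁆⇒x≡y x y∈x)) x∈q

  p⊆q∪⁅x⁆∧x∉p⇒p⊆q : ∀ {p q : Subset n} {x} → p ⊆ q ∪ ⁅ x ⁆ → x ∉ p → p ⊆ q
  p⊆q∪⁅x⁆∧x∉p⇒p⊆q {p} {q} {x} p⊆ x∉p y∈p with x∈p∪q⁻ q ⁅ x ⁆ (p⊆ y∈p)
  ... | inj₁ y∈q = y∈q
  ... | inj₂ y∈x = ⊥-elim (x∉p (subst (_∈ p) (x∈⁅y⁆⇒x≡y x y∈x) y∈p))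

  p⊆p-x∪⁅x⁆ : ∀ {p : Subset n} x → p ⊆ (p - x) ∪ ⁅ x ⁆
  p⊆p-x∪⁅x⁆ x {y} y∈p with y ≟ x
  ... | yes refl = x∈p∪q⁺ (inj₂ (x∈⁅x⁆ x))
  ... | no y≢x   = x∈p∪q⁺ (inj₁ (x∈p∧x≢y⇒x∈p-y y∈p y≢x))

module _ {n : ℕ} (M : Matroid n) where
  open Matroid M

  indep⇒HasRank : ∀ {A} → Indep A → HasRank M A ∣ A ∣
  indep⇒HasRank {A} indA = (A , ⊆-refl , indA , refl) , λ _ C⊆A _ → p⊆q⇒∣p∣≤∣q∣ C⊆A

  maximum-indep⊆⇒HasRank : ∀ {r B X} → HasRank M ⊤ r →
    Indep B → B ⊆ X → ∣ B ∣ ≡ r → HasRank M X r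
  maximum-indep⊆⇒HasRank {B = B} (_ , rank-bound) indB B⊆X ∣B∣≡r =
    (B , B⊆X , indB , ∣B∣≡r) , λ C _ indC → rank-bound C (λ _ → ∈⊤) indC

  rank≤∣B∣⇒basis : ∀ {r B} → HasRank M ⊤ r → Indep B → r ≤ ∣ B ∣ → IsBasis M B
  rank≤∣B∣⇒basis {r} {B} (_ , rank-bound) indB r≤∣B∣ = indB , maximal
    where
    maximal : ∀ X → Indep X → B ⊆ X → X ⊆ B
    maximal X indX B⊆X {x} x∈X with x ∈? B
    ... | yes x∈B = x∈B
    ... | no  x∉B = ⊥-elim (n≮n r (<-≤-trans (≤-<-trans r≤∣B∣ (x∉p⇒∣p∣<∣p∪⁅x⁆∣ x∉B))
                    (rank-bound _ (λ _ → ∈⊤) (indep-⊆ (p⊆q∧x∈q⇒p∪⁅x⁆⊆q B⊆X x∈X) indX))))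

  basis⇒∣B∣≡rank : ∀ {r B} → HasRank M ⊤ r → IsBasis M B → ∣ B ∣ ≡ r
  basis⇒∣B∣≡rank {r} {B} ((W , _ , indW , ∣W∣≡r) , rank-bound) (indB , maximal)
    with r ≤? ∣ B ∣
  ... | yes r≤∣B∣ = ≤-antisym (rank-bound B (λ _ → ∈⊤) indB) r≤∣B∣
  ... | no  r≰∣B∣ with exchange indB indW (subst (∣ B ∣ <_) (sym ∣W∣≡r) (≰⇒> r≰∣B∣))
  ... | y , _ , y∉B , indB∪y =
    ⊥-elim (y∉B (maximal _ indB∪y (p⊆p∪q ⁅ y ⁆) (x∈p∪q⁺ (inj₂ (x∈⁅x⁆ y)))))

  rank-jump⇒x∈indep : ∀ {k X A x} → HasRank M X k →
    A ⊆ X ∪ ⁅ x ⁆ → Indep A → ∣ A ∣ ≡ suc k → x ∈ A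
  rank-jump⇒x∈indep {k} {X} {A} {x} (_ , rank-bound) A⊆ indA ∣A∣≡1+k with x ∈? A
  ... | yes x∈A = x∈A
  ... | no  x∉A = ⊥-elim (n≮n k (subst (_≤ k) ∣A∣≡1+k
                    (rank-bound A (p⊆q∪⁅x⁆∧x∉p⇒p⊆q A⊆ x∉A) indA)))

  InUnionF⇒InUnionB : ∀ {k a} → HasRank M ⊤ (suc k) → InUnionF M k a → InUnionB M a
  InUnionF⇒InUnionB {k} {a} rankM
    (A , indA , ∣A∣≡k , j , rankA@(_ , rank-boundA) , (A′ , A′⊆ , indA′ , ∣A′∣≡1+j) , _) =
    A′ , rank≤∣B∣⇒basis rankM indA′ 1+k≤∣A′∣ , rank-jump⇒x∈indep rankA A′⊆ indA′ ∣A′∣≡1+j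
    where
    1+k≤∣A′∣ : suc k ≤ ∣ A′ ∣
    1+k≤∣A′∣ = subst (suc k ≤_) (sym ∣A′∣≡1+j)
                 (s≤s (subst (_≤ j) ∣A∣≡k (rank-boundA A ⊆-refl indA)))

  InUnionB⇒InUnionF : ∀ {k a} → HasRank M ⊤ (suc k) → InUnionB M a → InUnionF M k a
  InUnionB⇒InUnionF {k} {a} rankM (B , basisB@(indB , _) , a∈B) =
    B - a , indB-a , ∣B-a∣≡k , k ,
    subst (HasRank M (B - a)) ∣B-a∣≡k (indep⇒HasRank indB-a) ,
    maximum-indep⊆⇒HasRank rankM indB (p⊆p-x∪⁅x⁆ a) ∣B∣≡1+k
    where
    ∣B∣≡1+k : ∣ B ∣ ≡ suc k
    ∣B∣≡1+k = basis⇒∣B∣≡rank rankM basisB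
    indB-a : Indep (B - a)
    indB-a = indep-⊆ (p─q⊆p B ⁅ a ⁆) indB
    ∣B-a∣≡k : ∣ B - a ∣ ≡ k
    ∣B-a∣≡k = suc-injective (trans (sym (x∈p⇒∣p∣≡1+∣p-x∣ a∈B)) ∣B∣≡1+k)

proposition3 : (n : ℕ) (M : Matroid n) (k : ℕ) → HasRank M ⊤ (suc k) →
    (a : Fin n) → (InUnionF M k a → InUnionB M a) × (InUnionB M a → InUnionF M k a)
proposition3 n M k rankM a = InUnionF⇒InUnionB M rankM , InUnionB⇒InUnionF M rankM
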